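{- Let $X$ be a finite set and $\mathcal{D}\subseteq\mathcal{R}(X)$. Then $\mathcal{D}$ has the single-crossing property if and only if its associated graph $\Gamma_{\mathcal{D}}$ is a chain (a path graph).
   Context: $\mathcal{R}(X)$ is the set of strict linear orders on $X$. $\mathcal{D}$ has the single-crossing property if its elements can be enumerated $R_1,\dots,R_m$ so that for every pair of distinct $x,y\in X$ the sets $\{j: xR_jy\}$ and $\{j: yR_jx\}$ are each sets of consecutive indices (intervals in $\{1,\dots,m\}$). For $R,R'\in\mathcal{R}(X)$ let $[R,R']=\{Q\in\mathcal{R}(X): Q\supseteq R\cap R'\}$; $\Gamma_{\mathcal{D}}$ is the graph on $\mathcal{D}$ in which distinct $R,R'$ are adjacent iff $[R,R']\cap\mathcal{D}=\{R,R'\}$. -}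

module Defs where

open import Data.Nat using (ℕ; suc; _≤_)
open import Data.Fin using (Fin; toℕ)
open import Data.Product using (Σ; ∃; ∃-syntax; _×_; proj₁)
open import Data.Sum using (_⊎_)
open import Relation.Nullary using (¬_)
open import Relation.Binary.PropositionalEquality using (_≡_)
open import Relation.Binary.Structures using (IsStrictTotalOrder)
open import Function.Bundles using (_⇔_; _↔_; Inverse)

-- X is a finite set, taken w.l.o.g. to be Fin n.
-- A strict linear order on Fin n: a relation  x R y  ("x is ranked above y")
-- which is a strict total order (irreflexive, transitive, trichotomous).
LinOrd : ℕ → Set₁
LinOrd n = Σ (Fin n → Fin n → Set) (IsStrictTotalOrder _≡_)

rel : ∀ {n} → LinOrd n → Fin n → Fin n → Set
rel R = proj₁ R

_≈ₒ_ : ∀ {n} → LinOrd n → LinOrd n → Set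
R ≈ₒ R' = ∀ x y → rel R x y ⇔ rel R' x y

-- A domain D ⊆ R(X) with m elements, given by an indexing D : Fin m → LinOrd n
-- whose values are pairwise distinct (D is a set).
Distinct : ∀ {n m} → (Fin m → LinOrd n) → Set
Distinct {m = m} D = ∀ (i j : Fin m) → D i ≈ₒ D j → i ≡ j

-- Q ∈ [R,R']  iff  Q ⊇ R ∩ R'
InBetween : ∀ {n} → LinOrd n → LinOrd n → LinOrd n → Set
InBetween R R' Q = ∀ x y → rel R x y → rel R' x y → rel Q x y

-- Adjacency in Γ_D: R ≠ R' and [R,R'] ∩ D = {R,R'}
-- (R and R' always lie in [R,R'], so only ⊆ needs stating).
Adjacent : ∀ {n m} → (Fin m → LinOrd n) → LinOrd n → LinOrd n → Set
Adjacent {m = m} D R R' =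
  ¬ (R ≈ₒ R') ×
  (∀ (k : Fin m) → InBetween R R' (D k) → (D k ≈ₒ R) ⊎ (D k ≈ₒ R'))

IsInterval : ∀ {m} → (Fin m → Set) → Set
IsInterval {m} S = ∀ (i j k : Fin m) → toℕ i ≤ toℕ j → toℕ j ≤ toℕ k → S i → S k → S j

SingleCrossing : ∀ {n m} → (Fin m → LinOrd n) → Set
SingleCrossing {n} {m} D =
  Σ (Fin m ↔ Fin m) λ σ → ∀ (x y : Fin n) → ¬ (x ≡ y) →
      IsInterval (λ j → rel (D (Inverse.to σ j)) x y)
    × IsInterval (λ j → rel (D (Inverse.to σ j)) y x)

IsPathGraph : ∀ {n m} → (Fin m → LinOrd n) → Set
IsPathGraph {n} {m} D =
  Σ (Fin m ↔ Fin m) λ σ → ∀ (i j : Fin m) →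
    Adjacent D (D (Inverse.to σ i)) (D (Inverse.to σ j))
      ⇔ (toℕ i ≡ suc (toℕ j) ⊎ toℕ j ≡ suc (toℕ i))

module Submission where

-- Both properties of an enumeration P = D ∘ σ are shown equivalent to the
-- BETWEENNESS property: u ≤ b ≤ v implies P b ∈ [P u, P v].
--  * Single crossing ⇔ betweenness is a direct unfolding of the definitions.
--  * Betweenness ⇒ path: consecutive orders have nothing of D strictly
--    between them (anything between them coincides with one of them by
--    antisymmetry of betweenness), while non-consecutive ones have the
--    intermediate order of the enumeration between them.
--  * Path ⇒ betweenness: for u < b < v the orders P u, P v are not adjacent,
--    so some P w ∈ [P u, P v] differs from both.  Then P w is strictly closer
--    to each endpoint in the Kendall distance (number of inverted pairs),
--    and well-founded induction on that distance places P b in [P u, P w]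
--    or [P w, P v], hence in [P u, P v].
-- Since Γ_D only depends on the set of orders in D, the enumeration can be
-- used in place of D throughout.

open import Defs
open import Data.Nat using (ℕ; suc; _*_; _≤_; _<_; _≤?_; z≤n; s≤s)
open import Data.Nat.Properties
  using (≤-antisym; <-irrefl; <-trans; ≤-<-trans; <-cmp; <⇒≤; ≰⇒>; n≤1+n;
         1+n≢n; 1+n≰n; m≤n⇒m≤1+n; m≤n⇒m<n∨m≡n)
open import Data.Nat.Induction using (<-wellFounded)
open import Data.Fin using (Fin; toℕ; fromℕ<)
open import Data.Fin.Properties using (toℕ-injective; toℕ-fromℕ<; toℕ<n; any?; all?)
open import Data.Vec using (Vec; []; _∷_; count; allFin; allPairs)
open import Data.Vec.Membership.Propositional using (_∈_)
open import Data.Vec.Membership.Propositional.Properties using (∈-allFin⁺; ∈-allPairs⁺)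
open import Data.Vec.Relation.Unary.Any using (here; there)
open import Data.Product using (∃; ∃₂; _×_; _,_; proj₁; proj₂)
open import Data.Sum using (_⊎_; inj₁; inj₂; swap)
open import Data.Empty using (⊥; ⊥-elim)
open import Function using (_∘_)
open import Function.Bundles using (_⇔_; _↔_; mk⇔; Inverse; Injection; Equivalence)
open import Function.Definitions using (Injective; StrictlySurjective)
open import Function.Properties.Inverse using (↔⇒↣)
open import Function.Construct.Composition using (_⇔-∘_)
open import Function.Construct.Symmetry using (⇔-sym)
open import Induction.WellFounded using (Acc; acc)
open import Relation.Nullary using (¬_; Dec; yes; no; contradiction)
open import Relation.Nullary.Decidable using (map′; _×-dec_; _⊎-dec_; _→-dec_; ¬?)
open import Relation.Unary using (Decidable)
open import Relation.Binary.PropositionalEquality using (_≡_; _≢_; refl; sym; trans; cong; subst)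
open import Relation.Binary.Structures using (IsStrictTotalOrder)
open import Relation.Binary.Definitions using (tri<; tri≈; tri>)

module Orders {n : ℕ} where

  rel? : (R : LinOrd n) → ∀ x y → Dec (rel R x y)
  rel? R = IsStrictTotalOrder._<?_ (proj₂ R)

  asym : (R : LinOrd n) → ∀ {x y} → rel R x y → ¬ rel R y x
  asym R = IsStrictTotalOrder.asym (proj₂ R)

  rel⇒≢ : (R : LinOrd n) → ∀ {x y} → rel R x y → x ≢ y
  rel⇒≢ R r refl = IsStrictTotalOrder.irrefl (proj₂ R) refl r

  rel-flip : (R : LinOrd n) → ∀ {x y} → x ≢ y → ¬ rel R x y → rel R y x
  rel-flip R {x} {y} x≢y ¬r with IsStrictTotalOrder.compare (proj₂ R) x y
  ... | tri< r _ _ = contradiction r ¬r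
  ... | tri≈ _ e _ = contradiction e x≢y
  ... | tri> _ _ r = r

  ≡⇒≈ₒ : ∀ {A B : LinOrd n} → A ≡ B → A ≈ₒ B
  ≡⇒≈ₒ refl x y = mk⇔ (λ r → r) (λ r → r)

  ≈ₒ-sym : ∀ {A B : LinOrd n} → A ≈ₒ B → B ≈ₒ A
  ≈ₒ-sym A≈B x y = ⇔-sym (A≈B x y)

  _⊆ₒ_ : LinOrd n → LinOrd n → Set
  A ⊆ₒ B = ∀ x y → rel A x y → rel B x y

  ⊆⇒≈ₒ : ∀ (A B : LinOrd n) → A ⊆ₒ B → A ≈ₒ B
  ⊆⇒≈ₒ A B A⊆B x y = mk⇔ (A⊆B x y) back
    where
    back : rel B x y → rel A x y
    back b with rel? A x y
    ... | yes a = a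
    ... | no ¬a = contradiction (A⊆B y x (rel-flip A (rel⇒≢ B b) ¬a)) (asym B b)

  ≈ₒ? : ∀ (A B : LinOrd n) → Dec (A ≈ₒ B)
  ≈ₒ? A B = map′ (⊆⇒≈ₒ A B) (λ A≈B x y → Equivalence.to (A≈B x y))
                 (all? λ x → all? λ y → rel? A x y →-dec rel? B x y)

  between? : ∀ (A B C : LinOrd n) → Dec (InBetween A B C)
  between? A B C = all? λ x → all? λ y → rel? A x y →-dec rel? B x y →-dec rel? C x y

  between-sym : ∀ {A B C : LinOrd n} → InBetween A B C → InBetween B A C
  between-sym C∈AB x y b a = C∈AB x y a b

  between-narrowˡ : ∀ {A B C X : LinOrd n} → InBetween A B C → InBetween A C X → InBetween A B X
  between-narrowˡ C∈AB X∈AC x y a b = X∈AC x y a (C∈AB x y a b)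

  between-narrowʳ : ∀ {A B C X : LinOrd n} → InBetween A B C → InBetween C B X → InBetween A B X
  between-narrowʳ C∈AB X∈CB x y a b = X∈CB x y (C∈AB x y a b) b

  between-antisym : ∀ (A B C : LinOrd n) → InBetween A C B → InBetween B C A → A ≈ₒ B
  between-antisym A B C B∈AC A∈BC = ⊆⇒≈ₒ A B A⊆B
    where
    A⊆B : A ⊆ₒ B
    A⊆B x y a with rel? C x y | rel? B x y
    ... | yes c | _     = B∈AC x y a c
    ... | no _  | yes b = b
    ... | no ¬c | no ¬b =
      contradiction (A∈BC y x (rel-flip B x≢y ¬b) (rel-flip C x≢y ¬c)) (asym A a)
      where x≢y = rel⇒≢ A a

  between-inversion : ∀ {A B C : LinOrd n} {x y} → InBetween A B C →
    rel A x y → rel C y x → rel B y x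
  between-inversion {A} {B} {C} {x} {y} C∈AB a c with rel? B x y
  ... | yes b = contradiction (C∈AB x y a b) (asym C c)
  ... | no ¬b = rel-flip B (rel⇒≢ A a) ¬b

  ≉ₒ⇒inverted : ∀ (A B : LinOrd n) → ¬ (A ≈ₒ B) → ∃₂ λ x y → rel A x y × rel B y x
  ≉ₒ⇒inverted A B A≉B with any? (λ x → any? λ y → rel? A x y ×-dec rel? B y x)
  ... | yes (x , y , inv) = x , y , inv
  ... | no none = contradiction (⊆⇒≈ₒ A B A⊆B) A≉B
    where
    A⊆B : A ⊆ₒ B
    A⊆B x y a with rel? B x y
    ... | yes b = b
    ... | no ¬b = contradiction (x , y , a , rel-flip B (rel⇒≢ A a) ¬b) none

module Counting {a p q} {X : Set a} {P : X → Set p} {Q : X → Set q}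
                (P? : Decidable P) (Q? : Decidable Q) (P⇒Q : ∀ {x} → P x → Q x) where

  count-mono : ∀ {k} (xs : Vec X k) → count P? xs ≤ count Q? xs
  count-mono []       = z≤n
  count-mono (x ∷ xs) with P? x | Q? x
  ... | yes _ | yes _  = s≤s (count-mono xs)
  ... | yes p | no ¬q  = contradiction (P⇒Q p) ¬q
  ... | no _  | yes _  = m≤n⇒m≤1+n (count-mono xs)
  ... | no _  | no _   = count-mono xs

  count-strict : ∀ {k} {x} {xs : Vec X k} → x ∈ xs → Q x → ¬ P x → count P? xs < count Q? xs
  count-strict {x = x} {x ∷ xs} (here refl) q ¬p with P? x | Q? x
  ... | yes p | _     = contradiction p ¬p
  ... | no _  | yes _ = s≤s (count-mono xs)
  ... | no _  | no ¬q = contradiction q ¬q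
  count-strict {xs = y ∷ xs} (there x∈xs) q ¬p with P? y | Q? y
  ... | yes _ | yes _  = s≤s (count-strict x∈xs q ¬p)
  ... | yes p | no ¬q  = contradiction (P⇒Q p) ¬q
  ... | no _  | yes _  = m≤n⇒m≤1+n (count-strict x∈xs q ¬p)
  ... | no _  | no _   = count-strict x∈xs q ¬p

-- The distance between two orders: the number of ordered pairs (x , y) on
-- which they disagree (twice the Kendall tau distance).
module Distance {n : ℕ} where
  open Orders {n}

  Disagree : LinOrd n → LinOrd n → Fin n × Fin n → Set
  Disagree A B (x , y) = (rel A x y × rel B y x) ⊎ (rel B x y × rel A y x)

  disagree? : ∀ (A B : LinOrd n) → Decidable (Disagree A B)
  disagree? A B (x , y) = (rel? A x y ×-dec rel? B y x) ⊎-dec (rel? B x y ×-dec rel? A y x)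

  disagree-sym : ∀ (A B : LinOrd n) {p} → Disagree A B p → Disagree B A p
  disagree-sym A B {_ , _} = swap

  pairs : Vec (Fin n × Fin n) (n * n)
  pairs = allPairs (allFin n) (allFin n)

  dist : LinOrd n → LinOrd n → ℕ
  dist A B = count (disagree? A B) pairs

  dist-sym : ∀ (A B : LinOrd n) → dist A B ≡ dist B A
  dist-sym A B = ≤-antisym (dist-≤-swap A B) (dist-≤-swap B A)
    where
    dist-≤-swap : ∀ A B → dist A B ≤ dist B A
    dist-≤-swap A B = Counting.count-mono (disagree? A B) (disagree? B A) (disagree-sym A B) pairs

  -- B inverts relative to A every pair C does, plus one on which C and B differ
  closer-to-left : ∀ {A B C : LinOrd n} → InBetween A B C → ¬ (C ≈ₒ B) → dist A C < dist A B
  closer-to-left {A} {B} {C} C∈AB C≉B with ≉ₒ⇒inverted B C (C≉B ∘ ≈ₒ-sym {B} {C})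
  ... | x , y , b , c =
    Counting.count-strict (disagree? A C) (disagree? A B) AC⊆AB
      (∈-allPairs⁺ (∈-allFin⁺ x) (∈-allFin⁺ y))
      (inj₂ (b , a)) (λ { (inj₁ (a′ , _)) → asym A a a′ ; (inj₂ (c′ , _)) → asym C c c′ })
    where
    a : rel A y x
    a = between-inversion {B} {A} {C} (between-sym {A} {B} {C} C∈AB) b c
    AC⊆AB : ∀ {p} → Disagree A C p → Disagree A B p
    AC⊆AB {_ , _} (inj₁ (a , c)) = inj₁ (a , between-inversion {A} {B} {C} C∈AB a c)
    AC⊆AB {_ , _} (inj₂ (c , a)) = inj₂ (between-inversion {A} {B} {C} C∈AB a c , a)

  closer-to-right : ∀ {A B C : LinOrd n} → InBetween A B C → ¬ (C ≈ₒ A) → dist C B < dist A B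
  closer-to-right {A} {B} {C} C∈AB C≉A
    rewrite dist-sym C B | dist-sym A B =
      closer-to-left {B} {A} {C} (between-sym {A} {B} {C} C∈AB) C≉A

module Adjacency {n : ℕ} where
  open Orders {n}

  adjacent-sym : ∀ {k} {E : Fin k → LinOrd n} (A B : LinOrd n) → Adjacent E A B → Adjacent E B A
  adjacent-sym {E = E} A B (A≉B , only) =
    A≉B ∘ ≈ₒ-sym {B} {A} , λ w W∈BA → swap (only w (between-sym {B} {A} {E w} W∈BA))

  adjacent-reindex : ∀ {k l} (E : Fin k → LinOrd n) (f : Fin l → Fin k) →
    StrictlySurjective _≡_ f → ∀ A B → Adjacent E A B ⇔ Adjacent (E ∘ f) A B
  adjacent-reindex E f surj A B = mk⇔ restrict extend
    where
    restrict : Adjacent E A B → Adjacent (E ∘ f) A B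
    restrict (A≉B , only) = A≉B , λ w → only (f w)
    extend : Adjacent (E ∘ f) A B → Adjacent E A B
    extend (A≉B , only) = A≉B , λ j →
      subst (λ i → InBetween A B (E i) → E i ≈ₒ A ⊎ E i ≈ₒ B) (proj₂ (surj j)) (only (proj₁ (surj j)))

  nonadjacent-witness : ∀ {k} (E : Fin k → LinOrd n) (A B : LinOrd n) →
    ¬ (A ≈ₒ B) → ¬ Adjacent E A B →
    ∃ λ w → InBetween A B (E w) × ¬ (E w ≈ₒ A) × ¬ (E w ≈ₒ B)
  nonadjacent-witness E A B A≉B ¬adj
    with any? (λ w → between? A B (E w) ×-dec ¬? (≈ₒ? (E w) A) ×-dec ¬? (≈ₒ? (E w) B))
  ... | yes witness = witness
  ... | no none = contradiction (A≉B , only) ¬adj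
    where
    only : ∀ w → InBetween A B (E w) → E w ≈ₒ A ⊎ E w ≈ₒ B
    only w W∈AB with ≈ₒ? (E w) A | ≈ₒ? (E w) B
    ... | yes W≈A | _     = inj₁ W≈A
    ... | no _    | yes W≈B = inj₂ W≈B
    ... | no W≉A  | no W≉B = contradiction (w , W∈AB , W≉A , W≉B) none

module Enumeration {n m : ℕ} (P : Fin m → LinOrd n) (distinct : Distinct P) where
  open Orders {n}
  open Distance {n}
  open Adjacency {n}

  Betweenness : Set
  Betweenness = ∀ u b v → toℕ u ≤ toℕ b → toℕ b ≤ toℕ v → InBetween (P u) (P v) (P b)

  Consecutive : Fin m → Fin m → Set
  Consecutive i j = toℕ i ≡ suc (toℕ j) ⊎ toℕ j ≡ suc (toℕ i)

  IsPath : Set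
  IsPath = ∀ i j → Adjacent P (P i) (P j) ⇔ Consecutive i j

  ≈ₒ⇒toℕ≡ : ∀ {i j} → P i ≈ₒ P j → toℕ i ≡ toℕ j
  ≈ₒ⇒toℕ≡ = cong toℕ ∘ distinct _ _

  -- single crossing of P ⇔ betweenness: both say that x P_j y for j = i and
  -- j = k forces x P_j y for every j in between
  crossing⇒betweenness : (∀ x y → x ≢ y → IsInterval (λ j → rel (P j) x y)
                                          × IsInterval (λ j → rel (P j) y x)) → Betweenness
  crossing⇒betweenness crossing u b v u≤b b≤v x y pu pv =
    proj₁ (crossing x y (rel⇒≢ (P u) pu)) u b v u≤b b≤v pu pv

  betweenness⇒interval : Betweenness → ∀ x y → IsInterval (λ j → rel (P j) x y)
  betweenness⇒interval between x y i j k i≤j j≤k pi pk = between i j k i≤j j≤k x y pi pk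

  -- consecutive orders are adjacent: whatever lies between them lies on one side
  successor-adjacent : Betweenness → ∀ lo hi → toℕ hi ≡ suc (toℕ lo) → Adjacent P (P lo) (P hi)
  successor-adjacent between lo hi hi≡1+lo = lo≉hi , only
    where
    lo≤hi : toℕ lo ≤ toℕ hi
    lo≤hi = subst (toℕ lo ≤_) (sym hi≡1+lo) (n≤1+n _)
    lo≉hi : ¬ (P lo ≈ₒ P hi)
    lo≉hi lo≈hi = 1+n≢n (subst (_≡ toℕ lo) hi≡1+lo (sym (≈ₒ⇒toℕ≡ lo≈hi)))
    only : ∀ w → InBetween (P lo) (P hi) (P w) → P w ≈ₒ P lo ⊎ P w ≈ₒ P hi
    only w W∈ with toℕ w ≤? toℕ lo
    ... | yes w≤lo = inj₁ (between-antisym (P w) (P lo) (P hi) (between w lo hi w≤lo lo≤hi) W∈)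
    ... | no w≰lo  = inj₂ (between-antisym (P w) (P hi) (P lo)
                      (between-sym {P lo} {P w} {P hi} (between lo hi w lo≤hi hi≤w))
                      (between-sym {P lo} {P hi} {P w} W∈))
      where hi≤w = subst (_≤ toℕ w) (sym hi≡1+lo) (≰⇒> w≰lo)

  -- an adjacent pair i < j is consecutive: otherwise the index i + 1 lies between
  adjacent⇒successor : Betweenness → ∀ {i j} → toℕ i < toℕ j → Adjacent P (P i) (P j) →
    toℕ j ≡ suc (toℕ i)
  adjacent⇒successor between {i} {j} i<j (_ , only) with m≤n⇒m<n∨m≡n i<j
  ... | inj₂ 1+i≡j = sym 1+i≡j
  ... | inj₁ 1+i<j = ⊥-elim (neither (only b (between i b j i≤b b≤j)))
    where
    b : Fin m
    b = fromℕ< (<-trans 1+i<j (toℕ<n j))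
    b≡1+i : toℕ b ≡ suc (toℕ i)
    b≡1+i = toℕ-fromℕ< _
    i≤b : toℕ i ≤ toℕ b
    i≤b = subst (toℕ i ≤_) (sym b≡1+i) (n≤1+n _)
    b≤j : toℕ b ≤ toℕ j
    b≤j = subst (_≤ toℕ j) (sym b≡1+i) (<⇒≤ 1+i<j)
    neither : P b ≈ₒ P i ⊎ P b ≈ₒ P j → ⊥
    neither (inj₁ b≈i) = 1+n≢n (trans (sym b≡1+i) (≈ₒ⇒toℕ≡ b≈i))
    neither (inj₂ b≈j) = <-irrefl (trans (sym b≡1+i) (≈ₒ⇒toℕ≡ b≈j)) 1+i<j

  betweenness⇒path : Betweenness → IsPath
  betweenness⇒path between i j = mk⇔ adjacent⇒consecutive consecutive⇒adjacent
    where
    adjacent⇒consecutive : Adjacent P (P i) (P j) → Consecutive i j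
    adjacent⇒consecutive adj with <-cmp (toℕ i) (toℕ j)
    ... | tri< i<j _ _ = inj₂ (adjacent⇒successor between i<j adj)
    ... | tri≈ _ i≡j _ = contradiction (≡⇒≈ₒ (cong P (toℕ-injective i≡j))) (proj₁ adj)
    ... | tri> _ _ j<i =
      inj₁ (adjacent⇒successor between j<i (adjacent-sym {E = P} (P i) (P j) adj))
    consecutive⇒adjacent : Consecutive i j → Adjacent P (P i) (P j)
    consecutive⇒adjacent (inj₁ i≡1+j) =
      adjacent-sym {E = P} (P j) (P i) (successor-adjacent between j i i≡1+j)
    consecutive⇒adjacent (inj₂ j≡1+i) = successor-adjacent between i j j≡1+i

  <⇒≉ₒ : ∀ i j → toℕ i < toℕ j → ¬ (P i ≈ₒ P j)
  <⇒≉ₒ i j i<j i≈j = <-irrefl (≈ₒ⇒toℕ≡ i≈j) i<j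

  apart⇒nonadjacent : IsPath → ∀ {u b v : Fin m} → toℕ u < toℕ b → toℕ b < toℕ v →
    ¬ Adjacent P (P u) (P v)
  apart⇒nonadjacent path {u} {b} {v} u<b b<v adj with Equivalence.to (path u v) adj
  ... | inj₁ u≡1+v = 1+n≰n (<⇒≤ (subst (_< toℕ v) u≡1+v (<-trans u<b b<v)))
  ... | inj₂ v≡1+u = <-irrefl refl (≤-<-trans u<b (subst (toℕ b <_) v≡1+u b<v))

  -- a non-adjacent pair u < v has some P w between them other than both; as
  -- P w is closer to each endpoint, induction places P b in [P u , P w] or
  -- in [P w , P v], both contained in [P u , P v]
  between-by-distance : IsPath → ∀ u v → Acc _<_ (dist (P u) (P v)) →
    ∀ b → toℕ u ≤ toℕ b → toℕ b ≤ toℕ v → InBetween (P u) (P v) (P b)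
  between-by-distance path u v (acc smaller) b u≤b b≤v
    with m≤n⇒m<n∨m≡n u≤b | m≤n⇒m<n∨m≡n b≤v
  ... | inj₂ u≡b | _        =
    subst (InBetween (P u) (P v) ∘ P) (toℕ-injective u≡b) (λ _ _ pu _ → pu)
  ... | inj₁ _   | inj₂ b≡v =
    subst (InBetween (P u) (P v) ∘ P) (toℕ-injective (sym b≡v)) (λ _ _ _ pv → pv)
  ... | inj₁ u<b | inj₁ b<v
    with nonadjacent-witness P (P u) (P v) (<⇒≉ₒ u v (<-trans u<b b<v))
                             (apart⇒nonadjacent path u<b b<v)
  ...   | w , W∈UV , W≉U , W≉V with toℕ b ≤? toℕ w
  ...     | yes b≤w = between-narrowˡ {P u} {P v} {P w} {P b} W∈UV
                        (between-by-distance path u w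
                          (smaller (closer-to-left {P u} {P v} {P w} W∈UV W≉V)) b u≤b b≤w)
  ...     | no b≰w  = between-narrowʳ {P u} {P v} {P w} {P b} W∈UV
                        (between-by-distance path w v
                          (smaller (closer-to-right {P u} {P v} {P w} W∈UV W≉U))
                          b (<⇒≤ (≰⇒> b≰w)) b≤v)

  path⇒betweenness : IsPath → Betweenness
  path⇒betweenness path u b v = between-by-distance path u v (<-wellFounded _) b

distinct-reindex : ∀ {n k l} (D : Fin k → LinOrd n) (f : Fin l → Fin k) →
  Injective _≡_ _≡_ f → Distinct D → Distinct (D ∘ f)
distinct-reindex D f f-injective distinct i j Dfi≈Dfj = f-injective (distinct (f i) (f j) Dfi≈Dfj)

proposition4p1 : ∀ (n m : ℕ) (D : Fin m → LinOrd n) → Distinct D →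
    (SingleCrossing D → IsPathGraph D) × (IsPathGraph D → SingleCrossing D)
proposition4p1 n m D distinct = crossing⇒path , path⇒crossing
  where
  module Enum (σ : Fin m ↔ Fin m) =
    Enumeration (D ∘ Inverse.to σ)
                (distinct-reindex D (Inverse.to σ) (Injection.injective (↔⇒↣ σ)) distinct)

  reindex : (σ : Fin m ↔ Fin m) → ∀ i j → let P = D ∘ Inverse.to σ in
    Adjacent D (P i) (P j) ⇔ Adjacent P (P i) (P j)
  reindex σ i j = Adjacency.adjacent-reindex D (Inverse.to σ)
                    (λ k → Inverse.from σ k , Inverse.strictlyInverseˡ σ k)
                    (D (Inverse.to σ i)) (D (Inverse.to σ j))

  crossing⇒path : SingleCrossing D → IsPathGraph D
  crossing⇒path (σ , crossing) = σ , λ i j → path i j ⇔-∘ reindex σ i j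
    where
    open Enum σ
    path : IsPath
    path = betweenness⇒path (crossing⇒betweenness crossing)

  path⇒crossing : IsPathGraph D → SingleCrossing D
  path⇒crossing (σ , pathD) = σ , λ x y _ → betweenness⇒interval between x y
                                           , betweenness⇒interval between y x
    where
    open Enum σ
    between : Betweenness
    between = path⇒betweenness (λ i j → pathD i j ⇔-∘ ⇔-sym (reindex σ i j))
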